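{- Let $\Gamma$ be a set of MSO formulas in which the first-order variable $x$ does not occur free, and let $\Psi_1,\Psi_2$ be step-wMSO formulas. Then $\prod_x\Psi_1\sim_\Gamma\prod_x\Psi_2$ if and only if $\Psi_1\sim_\Gamma\Psi_2$.
   Context: MSO formulas over a finite alphabet $\Sigma$ are interpreted over pairs $(w,\sigma)$, $w\in\Sigma^+$, $\sigma$ a valuation mapping first-order variables to positions in $\{1,\dots,|w|\}$ and second-order variables to sets of positions; $\sigma[x\mapsto i]$ agrees with $\sigma$ except $x\mapsto i$. step-wMSO: $\Psi::=r\mid\varphi\,?\,\Psi_1:\Psi_2$ ($r$ in a weight set $R$), with $[\![r]\!](w,\sigma)=r$ and the conditional selecting $\Psi_1$ if $(w,\sigma)\models\varphi$ and $\Psi_2$ otherwise. $[\![\prod_x\Psi]\!](w,\sigma)$ is the multiset consisting of the single word $r_1\cdots r_{|w|}$ over $R$ with $r_i=[\![\Psi]\!](w,\sigma[x\mapsto i])$. $[\![\Gamma]\!]$ is the set of pairs satisfying every formula in $\Gamma$, and $\chi_1\sim_\Gamma\chi_2$ means $[\![\chi_1]\!](w,\sigma)=[\![\chi_2]\!](w,\sigma)$ for all $(w,\sigma)\in[\![\Gamma]\!]$. -}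

module Defs where

open import Data.Nat using (ℕ; zero; suc)
open import Data.Nat.Properties using () renaming (_≟_ to _≟ℕ_)
open import Data.Fin using (Fin; zero; suc; _<?_) renaming (_≟_ to _≟F_)
open import Data.Bool using (Bool; true; false; not; _∨_; if_then_else_)
open import Data.List using (List; []; _∷_; concatMap)
open import Data.Bool.ListAction using (any)
open import Data.Vec using (Vec; lookup; tabulate)
open import Data.Product using (_×_)
open import Data.Sum using (_⊎_)
open import Relation.Nullary using (does; ¬_)
open import Relation.Binary.PropositionalEquality using (_≡_)

-- MSO over the finite alphabet Σ = Fin k.
-- First-order variables and second-order variables are both named by ℕ
-- (two separate name spaces).  Positions of a word of length n are Fin n.

data MSO (k : ℕ) : Set where
  lab  : Fin k → ℕ → MSO k
  eqv  : ℕ → ℕ → MSO k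
  lt   : ℕ → ℕ → MSO k
  mem  : ℕ → ℕ → MSO k
  neg  : MSO k → MSO k
  disj : MSO k → MSO k → MSO k
  ex1  : ℕ → MSO k → MSO k
  ex2  : ℕ → MSO k → MSO k

record Valuation (n : ℕ) : Set where
  constructor val
  field
    fo : ℕ → Fin n
    so : ℕ → Fin n → Bool
open Valuation public

_[_↦_] : ∀ {n} → Valuation n → ℕ → Fin n → Valuation n
fo (σ [ x ↦ i ]) y = if does (y ≟ℕ x) then i else fo σ y
so (σ [ x ↦ i ]) = so σ

_[_↦ₛ_] : ∀ {n} → Valuation n → ℕ → (Fin n → Bool) → Valuation n
fo (σ [ X ↦ₛ S ]) = fo σ
so (σ [ X ↦ₛ S ]) Y = if does (Y ≟ℕ X) then S else so σ Y

allPos : (n : ℕ) → List (Fin n)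
allPos zero = []
allPos (suc n) = zero ∷ Data.List.map suc (allPos n)

allSubsets : (n : ℕ) → List (Fin n → Bool)
allSubsets zero = (λ ()) ∷ []
allSubsets (suc n) = concatMap (λ S → cons false S ∷ cons true S ∷ []) (allSubsets n)
  where
  cons : Bool → (Fin n → Bool) → Fin (suc n) → Bool
  cons b S zero = b
  cons b S (suc i) = S i

⟦_⟧ : ∀ {k n} → MSO k → Vec (Fin k) n → Valuation n → Bool
⟦ lab a x ⟧ w σ = does (lookup w (fo σ x) ≟F a)
⟦ eqv x y ⟧ w σ = does (fo σ x ≟F fo σ y)
⟦ lt x y ⟧ w σ = does (fo σ x <? fo σ y)
⟦ mem x X ⟧ w σ = so σ X (fo σ x)
⟦ neg φ ⟧ w σ = not (⟦ φ ⟧ w σ)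
⟦ disj φ ψ ⟧ w σ = ⟦ φ ⟧ w σ ∨ ⟦ ψ ⟧ w σ
⟦ ex1 x φ ⟧ w σ = any (λ i → ⟦ φ ⟧ w (σ [ x ↦ i ])) (allPos _)
⟦ ex2 X φ ⟧ w σ = any (λ S → ⟦ φ ⟧ w (σ [ X ↦ₛ S ])) (allSubsets _)

_,_⊨_ : ∀ {k n} → Vec (Fin k) n → Valuation n → MSO k → Set
w , σ ⊨ φ = ⟦ φ ⟧ w σ ≡ true

FreeFO : ∀ {k} → ℕ → MSO k → Set
FreeFO x (lab a y) = x ≡ y
FreeFO x (eqv y z) = x ≡ y ⊎ x ≡ z
FreeFO x (lt y z) = x ≡ y ⊎ x ≡ z
FreeFO x (mem y X) = x ≡ y
FreeFO x (neg φ) = FreeFO x φ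
FreeFO x (disj φ ψ) = FreeFO x φ ⊎ FreeFO x ψ
FreeFO x (ex1 y φ) = ¬ (x ≡ y) × FreeFO x φ
FreeFO x (ex2 X φ) = FreeFO x φ

FormulaSet : ℕ → Set₁
FormulaSet k = MSO k → Set

_,_⊨Γ_ : ∀ {k n} → Vec (Fin k) n → Valuation n → FormulaSet k → Set
w , σ ⊨Γ Γ = ∀ φ → Γ φ → w , σ ⊨ φ

data Step (k : ℕ) (R : Set) : Set where
  wt  : R → Step k R
  ite : MSO k → Step k R → Step k R → Step k R

⟦_⟧ˢ : ∀ {k R n} → Step k R → Vec (Fin k) n → Valuation n → R
⟦ wt r ⟧ˢ w σ = r
⟦ ite φ Ψ₁ Ψ₂ ⟧ˢ w σ = if ⟦ φ ⟧ w σ then ⟦ Ψ₁ ⟧ˢ w σ else ⟦ Ψ₂ ⟧ˢ w σ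

-- ⟦∏_x Ψ⟧(w,σ): the (single) word r₁⋯r_|w| over R
⟦∏_,_⟧ : ∀ {k R n} → ℕ → Step k R → Vec (Fin k) n → Valuation n → Vec R n
⟦∏ x , Ψ ⟧ w σ = tabulate (λ i → ⟦ Ψ ⟧ˢ w (σ [ x ↦ i ]))

-- Ψ₁ ∼_Γ Ψ₂  (words are nonempty: length suc m)
_∼[_]_ : ∀ {k R} → Step k R → FormulaSet k → Step k R → Set
Ψ₁ ∼[ Γ ] Ψ₂ = ∀ m (w : Vec _ (suc m)) (σ : Valuation (suc m)) →
  w , σ ⊨Γ Γ → ⟦ Ψ₁ ⟧ˢ w σ ≡ ⟦ Ψ₂ ⟧ˢ w σ

∏∼[_] : ∀ {k R} → FormulaSet k → ℕ → Step k R → Step k R → Set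
∏∼[ Γ ] x Ψ₁ Ψ₂ = ∀ m (w : Vec _ (suc m)) (σ : Valuation (suc m)) →
  w , σ ⊨Γ Γ → ⟦∏ x , Ψ₁ ⟧ w σ ≡ ⟦∏ x , Ψ₂ ⟧ w σ

module Submission where

-- Since x is not free in Γ, the models of Γ are closed under reassigning x; so
-- pointwise equivalence of Ψ₁ and Ψ₂ gives equality of the products letter by
-- letter.  Conversely, the letter of ∏ₓ Ψ at position σ(x) is the value of Ψ
-- at σ itself, because σ[x ↦ σ(x)] and σ agree everywhere.

open import Defs
open import Data.Nat using (ℕ)
open import Data.Nat.Properties using () renaming (_≟_ to _≟ℕ_)
open import Data.Fin using (Fin)
open import Data.Bool using (Bool; true; false; not; _∨_; if_then_else_)
open import Data.Bool.ListAction using (or; any)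
open import Data.List using (List)
open import Data.List.Properties using (map-cong)
open import Data.Vec using (Vec; lookup)
open import Data.Vec.Properties using (lookup∘tabulate; tabulate-cong)
open import Data.Product using (_,_)
open import Data.Sum using (inj₁; inj₂)
open import Function.Base using (_∘_)
open import Function.Bundles using (_⇔_; mk⇔)
open import Relation.Nullary using (¬_; yes; no; does)
open import Relation.Nullary.Decidable using (dec-true; dec-false)
open import Relation.Binary.PropositionalEquality
  using (_≡_; _≢_; refl; sym; trans; cong; cong₂)
open Relation.Binary.PropositionalEquality.≡-Reasoning

private
  variable
    k n : ℕ
    R : Set

any-cong : ∀ {A : Set} {f g : A → Bool} → (∀ a → f a ≡ g a) →
  (xs : List A) → any f xs ≡ any g xs
any-cong f≗g xs = cong or (map-cong f≗g xs)

SameSO : Valuation n → Valuation n → Set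
SameSO σ τ = ∀ X i → so σ X i ≡ so τ X i

SameFO : Valuation n → Valuation n → Set
SameFO σ τ = ∀ y → fo σ y ≡ fo τ y

fo-[↦]-≡ : (σ : Valuation n) (x : ℕ) (i : Fin n) → fo (σ [ x ↦ i ]) x ≡ i
fo-[↦]-≡ σ x i = cong (if_then i else fo σ x) (dec-true (x ≟ℕ x) refl)

fo-[↦]-≢ : (σ : Valuation n) (x : ℕ) (i : Fin n) {y : ℕ} →
  y ≢ x → fo (σ [ x ↦ i ]) y ≡ fo σ y
fo-[↦]-≢ σ x i {y} y≢x = cong (if_then i else fo σ y) (dec-false (y ≟ℕ x) y≢x)

fo-[↦]-self : (σ : Valuation n) (x : ℕ) → SameFO (σ [ x ↦ fo σ x ]) σ
fo-[↦]-self σ x y with y ≟ℕ x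
... | yes refl = fo-[↦]-≡ σ x (fo σ x)
... | no y≢x   = fo-[↦]-≢ σ x (fo σ x) y≢x

so-[↦ₛ]-cong : (σ τ : Valuation n) (X : ℕ) (S : Fin n → Bool) →
  SameSO σ τ → SameSO (σ [ X ↦ₛ S ]) (τ [ X ↦ₛ S ])
so-[↦ₛ]-cong σ τ X S σ≈τ Y i with does (Y ≟ℕ X)
... | true  = refl
... | false = σ≈τ Y i

⟦⟧-coincidence : (φ : MSO k) (w : Vec (Fin k) n) {σ τ : Valuation n} →
  (∀ y → FreeFO y φ → fo σ y ≡ fo τ y) → SameSO σ τ →
  ⟦ φ ⟧ w σ ≡ ⟦ φ ⟧ w τ
⟦⟧-coincidence (lab a x) w fo≈ so≈ rewrite fo≈ x refl = refl
⟦⟧-coincidence (eqv x y) w fo≈ so≈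
  rewrite fo≈ x (inj₁ refl) | fo≈ y (inj₂ refl) = refl
⟦⟧-coincidence (lt x y) w fo≈ so≈
  rewrite fo≈ x (inj₁ refl) | fo≈ y (inj₂ refl) = refl
⟦⟧-coincidence (mem x X) w {τ = τ} fo≈ so≈ rewrite fo≈ x refl = so≈ X (fo τ x)
⟦⟧-coincidence (neg φ) w fo≈ so≈ = cong not (⟦⟧-coincidence φ w fo≈ so≈)
⟦⟧-coincidence (disj φ ψ) w fo≈ so≈ =
  cong₂ _∨_ (⟦⟧-coincidence φ w (λ y → fo≈ y ∘ inj₁) so≈)
            (⟦⟧-coincidence ψ w (λ y → fo≈ y ∘ inj₂) so≈)
⟦⟧-coincidence (ex1 x φ) w {σ} {τ} fo≈ so≈ =
  any-cong (λ i → ⟦⟧-coincidence φ w (fo≈-[x↦ i ]) so≈) (allPos _)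
  where
  fo≈-[x↦_] : ∀ i y → FreeFO y φ → fo (σ [ x ↦ i ]) y ≡ fo (τ [ x ↦ i ]) y
  fo≈-[x↦ i ] y free with y ≟ℕ x
  ... | yes refl = trans (fo-[↦]-≡ σ x i) (sym (fo-[↦]-≡ τ x i))
  ... | no y≢x   = begin
    fo (σ [ x ↦ i ]) y  ≡⟨ fo-[↦]-≢ σ x i y≢x ⟩
    fo σ y              ≡⟨ fo≈ y (y≢x , free) ⟩
    fo τ y              ≡⟨ fo-[↦]-≢ τ x i y≢x ⟨
    fo (τ [ x ↦ i ]) y  ∎
⟦⟧-coincidence (ex2 X φ) w {σ} {τ} fo≈ so≈ =
  any-cong (λ S → ⟦⟧-coincidence φ w fo≈ (so-[↦ₛ]-cong σ τ X S so≈)) (allSubsets _)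

⟦⟧ˢ-cong : (Ψ : Step k R) (w : Vec (Fin k) n) {σ τ : Valuation n} →
  SameFO σ τ → SameSO σ τ → ⟦ Ψ ⟧ˢ w σ ≡ ⟦ Ψ ⟧ˢ w τ
⟦⟧ˢ-cong (wt r) w fo≈ so≈ = refl
⟦⟧ˢ-cong (ite φ Ψ₁ Ψ₂) w fo≈ so≈
  rewrite ⟦⟧-coincidence φ w (λ y _ → fo≈ y) so≈
        | ⟦⟧ˢ-cong Ψ₁ w fo≈ so≈
        | ⟦⟧ˢ-cong Ψ₂ w fo≈ so≈ = refl

⟦⟧-[↦]-nonfree : (φ : MSO k) (w : Vec (Fin k) n) (σ : Valuation n) {x : ℕ}
  (i : Fin n) → ¬ FreeFO x φ → ⟦ φ ⟧ w (σ [ x ↦ i ]) ≡ ⟦ φ ⟧ w σ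
⟦⟧-[↦]-nonfree φ w σ {x} i x∉φ =
  ⟦⟧-coincidence φ w fo≈ (λ _ _ → refl)
  where
  fo≈ : ∀ y → FreeFO y φ → fo (σ [ x ↦ i ]) y ≡ fo σ y
  fo≈ y y∈φ = fo-[↦]-≢ σ x i (λ { refl → x∉φ y∈φ })

⊨Γ-[↦] : {Γ : FormulaSet k} {x : ℕ} → (∀ φ → Γ φ → ¬ FreeFO x φ) →
  {w : Vec (Fin k) n} {σ : Valuation n} (i : Fin n) →
  w , σ ⊨Γ Γ → w , σ [ x ↦ i ] ⊨Γ Γ
⊨Γ-[↦] x∉Γ {w} {σ} i w,σ⊨Γ φ φ∈Γ =
  trans (⟦⟧-[↦]-nonfree φ w σ i (x∉Γ φ φ∈Γ)) (w,σ⊨Γ φ φ∈Γ)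

lookup-⟦∏⟧-at-x : (x : ℕ) (Ψ : Step k R) (w : Vec (Fin k) n) (σ : Valuation n) →
  lookup (⟦∏ x , Ψ ⟧ w σ) (fo σ x) ≡ ⟦ Ψ ⟧ˢ w σ
lookup-⟦∏⟧-at-x x Ψ w σ = begin
  lookup (⟦∏ x , Ψ ⟧ w σ) (fo σ x)   ≡⟨ lookup∘tabulate _ (fo σ x) ⟩
  ⟦ Ψ ⟧ˢ w (σ [ x ↦ fo σ x ])        ≡⟨ ⟦⟧ˢ-cong Ψ w (fo-[↦]-self σ x) (λ _ _ → refl) ⟩
  ⟦ Ψ ⟧ˢ w σ                         ∎

lemma4 : ∀ {k : ℕ} {R : Set} (Γ : FormulaSet k) (x : ℕ) →
    (∀ φ → Γ φ → ¬ FreeFO x φ) →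
    (Ψ₁ Ψ₂ : Step k R) →
    (∏∼[ Γ ] x Ψ₁ Ψ₂) ⇔ (Ψ₁ ∼[ Γ ] Ψ₂)
lemma4 Γ x x∉Γ Ψ₁ Ψ₂ = mk⇔ letterwise products
  where
  letterwise : ∏∼[ Γ ] x Ψ₁ Ψ₂ → Ψ₁ ∼[ Γ ] Ψ₂
  letterwise ∏≈ m w σ w,σ⊨Γ = begin
    ⟦ Ψ₁ ⟧ˢ w σ                          ≡⟨ lookup-⟦∏⟧-at-x x Ψ₁ w σ ⟨
    lookup (⟦∏ x , Ψ₁ ⟧ w σ) (fo σ x)    ≡⟨ cong (λ v → lookup v (fo σ x)) (∏≈ m w σ w,σ⊨Γ) ⟩
    lookup (⟦∏ x , Ψ₂ ⟧ w σ) (fo σ x)    ≡⟨ lookup-⟦∏⟧-at-x x Ψ₂ w σ ⟩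
    ⟦ Ψ₂ ⟧ˢ w σ                          ∎

  products : Ψ₁ ∼[ Γ ] Ψ₂ → ∏∼[ Γ ] x Ψ₁ Ψ₂
  products Ψ≈ m w σ w,σ⊨Γ =
    tabulate-cong (λ i → Ψ≈ m w (σ [ x ↦ i ]) (⊨Γ-[↦] x∉Γ i w,σ⊨Γ))
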